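{- Let $M$ be a maximal path-like map such that $\mathbf{P}_{VEF}(M)$ has a realizer $\{L_1,L_2,L_3\}$, and fix an angle coloring of $M$ induced by this realizer. Then no two angles of the same interior triangle receive the same color.
   Context: A planar map consists of a finite planar multigraph with a plane drawing; $\mathbf{P}_{VEF}(M)$ is the poset on vertices, edges and faces ordered by incidence/inclusion. A realizer of a poset $\mathbf{P}$ is a family of linear extensions of $\mathbf{P}$ whose intersection is $\mathbf{P}$; a pair $(a,b)$ is reversed in a linear extension $L$ if $b<a$ in $L$. A simple 2-connected outerplanar map $M$ has a unique Hamilton cycle; its edges are cycle edges, the other edges chordal edges. $M$ is path-like if its interior dual (the dual graph restricted to bounded faces) is a simple path; then the Hamilton cycle bounds the outer face $F_\infty$. $M$ is maximal path-like if moreover every bounded face is a triangle. An inner angle is a pair $(u,T)$ with $T$ an interior triangle and $u$ a vertex of $T$. If $T$ has vertices $u,v,w$, the critical pair of the angle $(u,T)$ is $(u,vw)$ if $vw$ is a cycle edge, and $(u,F)$ where $F$ is the other interior face containing the edge $vw$ if $vw$ is a chordal edge. An angle coloring induced by the realizer assigns to every inner angle a color $i\in\{1,2,3\}$ such that the critical pair of the angle is reversed in $L_i$. -}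

module Defs where

open import Data.Nat using (ℕ; zero; suc; _≤_)
open import Data.Fin using (Fin; toℕ; _<_)
open import Data.Product using (Σ; Σ-syntax; ∃; ∃-syntax; _×_; _,_)
open import Data.Sum using (_⊎_)
open import Data.Empty using (⊥)
open import Data.Unit using (⊤)
open import Data.List using (List)
open import Data.List.Membership.Propositional using (_∈_)
open import Relation.Nullary using (¬_)
open import Relation.Binary.PropositionalEquality using (_≡_; _≢_)
open import Function.Bundles using (_⇔_)

-- A simple 2-connected outerplanar map whose Hamilton cycle bounds the
-- outer face is (up to isomorphism of maps) a convex n-gon with vertices
-- 0,1,…,n-1 in cyclic order plus a set of pairwise non-crossing
-- diagonals (chords).  "Every bounded face is a triangle" means that the
-- chord set is a maximal non-crossing set (a triangulation).

module _ (n : ℕ) where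

  CycleEdge : Fin n → Fin n → Set
  CycleEdge i j = (suc (toℕ i) ≡ toℕ j) ⊎ ((toℕ i ≡ 0) × (suc (toℕ j) ≡ n))

  Crosses : Fin n × Fin n → Fin n × Fin n → Set
  Crosses (a , b) (c , d) = (a < c × c < b × b < d) ⊎ (c < a × a < d × d < b)

  IsDiagonal : Fin n × Fin n → Set
  IsDiagonal (i , j) = i < j × ¬ CycleEdge i j

record MaxOuterMap : Set where
  field
    n         : ℕ
    3≤n       : 3 ≤ n
    chords    : List (Fin n × Fin n)
    chordsDiag : ∀ {p} → p ∈ chords → IsDiagonal n p
    nonCrossing : ∀ {p q} → p ∈ chords → q ∈ chords → ¬ Crosses n p q
    maximal   : ∀ p → IsDiagonal n p → ¬ p ∈ chords →
                Σ[ q ∈ Fin n × Fin n ] (q ∈ chords × Crosses n p q)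

module Map (M : MaxOuterMap) where
  open MaxOuterMap M public

  V : Set
  V = Fin n

  Chord : V → V → Set
  Chord i j = (i , j) ∈ chords

  Edge : V → V → Set
  Edge i j = i < j × (CycleEdge n i j ⊎ Chord i j)

  -- interior (bounded) triangle with vertices a < b < c
  IsTri : V → V → V → Set
  IsTri a b c = Edge a b × Edge b c × Edge a c

  record Tri : Set where
    constructor mkTri
    field
      a b c : V
      isTri : IsTri a b c

  open Tri public

  -- elements of P_VEF(M): vertices, edges, bounded faces, outer face
  data Elem : Set where
    vtx   : V → Elem
    edg   : V → V → Elem
    tri   : V → V → V → Elem
    outer : Elem

  Valid : Elem → Set
  Valid (vtx v)     = ⊤
  Valid (edg i j)   = Edge i j
  Valid (tri a b c) = IsTri a b c
  Valid outer       = ⊤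

  _≺_ : Elem → Elem → Set
  vtx v ≺ edg i j = (v ≡ i) ⊎ (v ≡ j)
  vtx v ≺ tri a b c = (v ≡ a) ⊎ (v ≡ b) ⊎ (v ≡ c)
  vtx v ≺ outer = ⊤
  edg i j ≺ tri a b c = (i ≡ a × j ≡ b) ⊎ (i ≡ b × j ≡ c) ⊎ (i ≡ a × j ≡ c)
  edg i j ≺ outer = CycleEdge n i j
  _ ≺ _ = ⊥

  triElem : Tri → Elem
  triElem T = tri (a T) (b T) (c T)

  Adjacent : Tri → Tri → Set
  Adjacent T T' = triElem T ≢ triElem T' ×
    Σ[ v ∈ V ] Σ[ w ∈ V ] (Edge v w × edg v w ≺ triElem T × edg v w ≺ triElem T')

  InteriorDualIsPath : Set
  InteriorDualIsPath = Σ[ m ∈ ℕ ] Σ[ f ∈ (Fin m → Tri) ]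
    ((∀ T → Σ[ k ∈ Fin m ] triElem (f k) ≡ triElem T) ×
     (∀ k l → triElem (f k) ≡ triElem (f l) → k ≡ l) ×
     (∀ k l → Adjacent (f k) (f l) ⇔ ((suc (toℕ k) ≡ toℕ l) ⊎ (suc (toℕ l) ≡ toℕ k))))

  -- a linear extension of P_VEF(M), given as an injective rank function
  -- (on valid elements) into ℕ; x is below y in L iff rank x < rank y
  record LinExt : Set where
    field
      rank    : Elem → ℕ
      inj     : ∀ x y → Valid x → Valid y → rank x ≡ rank y → x ≡ y
      extends : ∀ x y → Valid x → Valid y → x ≺ y → rank x Data.Nat.< rank y

  open LinExt public

  -- {L₁,L₂,L₃} is a realizer: the intersection of the L_i is P_VEF(M)
  IsRealizer : (Fin 3 → LinExt) → Set
  IsRealizer L = ∀ x y → Valid x → Valid y →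
    (∀ i → rank (L i) x Data.Nat.< rank (L i) y) → x ≺ y

  corner : Tri → Fin 3 → V
  corner T Fin.zero = a T
  corner T (Fin.suc Fin.zero) = b T
  corner T (Fin.suc (Fin.suc Fin.zero)) = c T

  opposite : Tri → Fin 3 → V × V
  opposite T Fin.zero = b T , c T
  opposite T (Fin.suc Fin.zero) = a T , c T
  opposite T (Fin.suc (Fin.suc Fin.zero)) = a T , b T

  -- x is the second component of the critical pair of the angle (corner T k, T)
  CriticalOf : Tri → Fin 3 → Elem → Set
  CriticalOf T k x with opposite T k
  ... | v , w =
    (CycleEdge n v w × x ≡ edg v w) ⊎
    (Chord v w × Σ[ F ∈ Tri ] (x ≡ triElem F × edg v w ≺ triElem F × triElem F ≢ triElem T))

  IsAngleColoring : (Fin 3 → LinExt) → (Tri → Fin 3 → Fin 3) → Set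
  IsAngleColoring L col = ∀ T k x → CriticalOf T k x →
    rank (L (col T k)) x Data.Nat.< rank (L (col T k)) (vtx (corner T k))

MaxPathLike : MaxOuterMap → Set
MaxPathLike M = Map.InteriorDualIsPath M

{-# OPTIONS --safe #-}
-- The critical element x of the angle at
-- a corner is the opposite side or the face across it, so in every linear
-- extension both other corners lie below x. If the angles at corners j ≠ k both
-- had colour i, then in L_i we would get x_j < j < x_k < k < x_j.
module Submission where

open import Defs
open import Data.Fin using (Fin; zero; suc; toℕ; fromℕ; fromℕ<; _<_; _≤_)
import Data.Fin.Properties as Fin
open import Data.Nat as ℕ using (suc; _+_; z≤n; s≤s; s≤s⁻¹)
open import Data.Nat.Properties
open import Data.Product using (_×_; _,_; Σ-syntax; proj₁; proj₂)
open import Data.Product.Properties using (≡-dec)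
open import Data.Sum using (_⊎_; inj₁; inj₂)
open import Data.Empty using (⊥; ⊥-elim)
open import Data.Unit using (tt)
open import Function using (_∘_)
open import Relation.Nullary using (¬_; Dec; yes; no)
open import Relation.Nullary.Decidable using (_⊎-dec_; _×-dec_)
open import Relation.Binary using (tri<; tri≈; tri>)
open import Relation.Binary.PropositionalEquality
import Data.List.Membership.DecPropositional as DecMembership

extremal-vertices : ∀ {n} → Fin n → Σ[ z ∈ Fin n ] Σ[ l ∈ Fin n ] (toℕ z ≡ 0 × suc (toℕ l) ≡ n)
extremal-vertices {suc m} _ = zero , fromℕ m , refl , cong suc (Fin.toℕ-fromℕ m)

no-gap-between-consecutive : ∀ {u v w} → suc v ≡ w → v ℕ.< u → u ℕ.< w → ⊥
no-gap-between-consecutive refl v<u u<w = <⇒≱ u<w v<u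

fuel-step-up : ∀ {u d w k} → u ℕ.< d → w ℕ.≤ u + suc k → w ℕ.≤ d + k
fuel-step-up {u} {d} {w} {k} u<d w≤ = ≤-trans w≤ (subst (ℕ._≤ d + k) (sym (+-suc u k)) (+-monoˡ-≤ k u<d))

fuel-step-down : ∀ {p u q k} → u ℕ.< q → q ℕ.≤ p + suc k → u ℕ.≤ p + k
fuel-step-down {p} {k = k} u<q q≤ = s≤s⁻¹ (subst (ℕ._≤_ _) (+-suc p k) (≤-trans u<q q≤))

module _ (M : MaxOuterMap) where
  open Map M

  open DecMembership (≡-dec (Fin._≟_ {n}) (Fin._≟_ {n})) using (_∈?_)

  cycle-edge? : ∀ v w → Dec (CycleEdge n v w)
  cycle-edge? v w = (suc (toℕ v) ℕ.≟ toℕ w) ⊎-dec ((toℕ v ℕ.≟ 0) ×-dec (suc (toℕ w) ℕ.≟ n))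

  edge? : ∀ v w → Dec (Edge v w)
  edge? v w = (v Fin.<? w) ×-dec (cycle-edge? v w ⊎-dec ((v , w) ∈? chords))

  chord-gap : ∀ {v w} → Chord v w → suc (toℕ v) ℕ.< toℕ w
  chord-gap ch with chordsDiag ch
  ... | v<w , ¬cycle = ≤∧≢⇒< v<w (¬cycle ∘ inj₁)

  edge-uncrossed : ∀ {v w c d} → Edge v w → Chord c d → ¬ Crosses n (v , w) (c , d)
  edge-uncrossed (_ , inj₂ ch) chcd = nonCrossing ch chcd
  edge-uncrossed (_ , inj₁ (inj₁ v+1≡w)) _ (inj₁ (v<c , c<w , _)) = no-gap-between-consecutive v+1≡w v<c c<w
  edge-uncrossed (_ , inj₁ (inj₁ v+1≡w)) _ (inj₂ (_ , v<d , d<w)) = no-gap-between-consecutive v+1≡w v<d d<w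
  edge-uncrossed {d = d} (_ , inj₁ (inj₂ (_ , w+1≡n))) _ (inj₁ (_ , _ , w<d)) =
    <⇒≱ (Fin.toℕ<n d) (subst (ℕ._≤ toℕ d) w+1≡n w<d)
  edge-uncrossed (_ , inj₁ (inj₂ (v≡0 , _))) _ (inj₂ (c<v , _ , _)) =
    <⇒≱ c<v (subst (ℕ._≤ _) (sym v≡0) z≤n)

  InnerApex : V → V → Set
  InnerApex v w = Σ[ u ∈ V ] (v < u × u < w × Edge v u × Edge u w)

  -- Invariant: vu is an edge. If uw is not, a chord crosses uw; as it cannot
  -- cross vw or vu, it leaves v and ends beyond u, so u can advance.
  inner-apex-from : ∀ k {v w u} → toℕ w ℕ.≤ toℕ u + k → Edge v w →
                    v < u → u < w → Edge v u → InnerApex v w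
  inner-apex-from ℕ.zero {u = u} w≤u+0 _ _ u<w _ =
    ⊥-elim (<⇒≱ u<w (subst (ℕ._≤_ _) (+-identityʳ (toℕ u)) w≤u+0))
  inner-apex-from (suc k) {v} {w} {u} w≤ evw v<u u<w evu with edge? u w
  ... | yes euw = u , v<u , u<w , evu , euw
  ... | no ¬euw with maximal (u , w) (u<w , ¬euw ∘ (u<w ,_) ∘ inj₁) (¬euw ∘ (u<w ,_) ∘ inj₂)
  ... | (c , d) , chcd , inj₁ (u<c , c<w , w<d) =
    ⊥-elim (edge-uncrossed evw chcd (inj₁ (<-trans v<u u<c , c<w , w<d)))
  ... | (c , d) , chcd , inj₂ (c<u , u<d , d<w) with Fin.<-cmp c v
  ...   | tri< c<v _ _ = ⊥-elim (edge-uncrossed evw chcd (inj₂ (c<v , <-trans v<u u<d , d<w)))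
  ...   | tri> _ _ v<c = ⊥-elim (edge-uncrossed evu chcd (inj₁ (v<c , c<u , u<d)))
  ...   | tri≈ _ refl _ =
    inner-apex-from k (fuel-step-up u<d w≤) evw v<d d<w (v<d , inj₂ chcd)
    where
      v<d : v < d
      v<d = <-trans v<u u<d

  inner-apex : ∀ {v w} → Edge v w → suc (toℕ v) ℕ.< toℕ w → InnerApex v w
  inner-apex {v} {w} evw gap =
    inner-apex-from (toℕ w) (m≤n+m (toℕ w) (toℕ v⁺)) evw v<v⁺ v⁺<w (v<v⁺ , inj₁ (inj₁ (sym v⁺≡v+1)))
    where
      v⁺ : V
      v⁺ = fromℕ< (<-trans gap (Fin.toℕ<n w))
      v⁺≡v+1 : toℕ v⁺ ≡ suc (toℕ v)
      v⁺≡v+1 = Fin.toℕ-fromℕ< _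
      v<v⁺ : v < v⁺
      v<v⁺ = ≤-reflexive (sym v⁺≡v+1)
      v⁺<w : v⁺ < w
      v⁺<w = subst (ℕ._< toℕ w) (sym v⁺≡v+1) gap

  OuterApex : V → V → Set
  OuterApex a c = Σ[ u ∈ V ] (u < a × Edge u a × Edge u c)
                ⊎ Σ[ u ∈ V ] (c < u × Edge c u × Edge a u)

  module _ {a c : V} (chac : Chord a c) where

    -- Invariant: the edge pq encloses the chord ac. The apex u of the triangle
    -- on pq inside cannot lie strictly between a and c (a side of that triangle
    -- would cross ac), so pu or uq still encloses ac, unless pq = ac is reached.
    outer-apex-from : ∀ k {p q} → toℕ q ℕ.≤ toℕ p + k → Edge p q →
                      p ≤ a → c ≤ q → ¬ (p ≡ a × q ≡ c) → OuterApex a c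
    outer-apex-from ℕ.zero {p} {q} q≤p+0 (p<q , _) _ _ _ =
      ⊥-elim (<⇒≱ p<q (subst (ℕ._≤_ _) (+-identityʳ (toℕ p)) q≤p+0))
    outer-apex-from (suc k) {p} {q} q≤ epq p≤a c≤q p,q≢a,c
      with inner-apex epq (≤-<-trans (s≤s p≤a) (<-≤-trans (chord-gap chac) c≤q))
    ... | u , p<u , u<q , epu , euq with Fin.<-cmp u a
    ...   | tri< u<a _ _ =
      outer-apex-from k (fuel-step-up p<u q≤) euq (<⇒≤ u<a) c≤q (Fin.<⇒≢ u<a ∘ proj₁)
    ...   | tri≈ _ refl _ with q Fin.≟ c
    ...     | yes refl = inj₁ (p , p<u , epu , epq)
    ...     | no q≢c = outer-apex-from k (fuel-step-up p<u q≤) euq ≤-refl c≤q (q≢c ∘ proj₂)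
    outer-apex-from (suc k) {p} {q} q≤ epq p≤a c≤q p,q≢a,c
        | u , p<u , u<q , epu , euq | tri> _ _ a<u with Fin.<-cmp u c
    ...   | tri> _ _ c<u =
      outer-apex-from k (fuel-step-down u<q q≤) epu p≤a (<⇒≤ c<u) (Fin.<⇒≢ c<u ∘ sym ∘ proj₂)
    ...   | tri≈ _ refl _ with p Fin.≟ a
    ...     | yes refl = inj₂ (q , u<q , euq , epq)
    ...     | no p≢a = outer-apex-from k (fuel-step-down u<q q≤) epu p≤a ≤-refl (p≢a ∘ proj₁)
    outer-apex-from (suc k) {p} {q} q≤ epq p≤a c≤q p,q≢a,c
        | u , p<u , u<q , epu , euq | tri> _ _ a<u | tri< u<c _ _ with p Fin.≟ a
    ...   | yes refl = ⊥-elim (edge-uncrossed euq chac (inj₂ (a<u , u<c , c<q)))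
      where
        c<q : c < q
        c<q = Fin.≤∧≢⇒< c≤q (p,q≢a,c ∘ (refl ,_) ∘ sym)
    ...   | no p≢a = ⊥-elim (edge-uncrossed epu chac (inj₁ (Fin.≤∧≢⇒< p≤a p≢a , a<u , u<c)))

    outer-apex : OuterApex a c
    outer-apex with extremal-vertices a
    ... | z , l , z≡0 , l+1≡n =
      outer-apex-from (toℕ l) (m≤n+m (toℕ l) (toℕ z)) ezl z≤a c≤l z,l≢a,c
      where
        z≤a : z ≤ a
        z≤a = subst (ℕ._≤ toℕ a) (sym z≡0) z≤n
        c≤l : c ≤ l
        c≤l = s≤s⁻¹ (subst (ℕ._<_ (toℕ c)) (sym l+1≡n) (Fin.toℕ<n c))
        ezl : Edge z l
        ezl = ≤-<-trans z≤a (<-≤-trans (proj₁ (chordsDiag chac)) c≤l) , inj₁ (inj₂ (z≡0 , l+1≡n))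
        z,l≢a,c : ¬ (z ≡ a × l ≡ c)
        z,l≢a,c (refl , refl) = proj₂ (chordsDiag chac) (inj₂ (z≡0 , l+1≡n))

  side-is-edge : ∀ T k → Edge (proj₁ (opposite T k)) (proj₂ (opposite T k))
  side-is-edge T zero = proj₁ (proj₂ (isTri T))
  side-is-edge T (suc zero) = proj₂ (proj₂ (isTri T))
  side-is-edge T (suc (suc zero)) = proj₁ (isTri T)

  face-across-chord : ∀ T k → Chord (proj₁ (opposite T k)) (proj₂ (opposite T k)) →
    Σ[ F ∈ Tri ] (edg (proj₁ (opposite T k)) (proj₂ (opposite T k)) ≺ triElem F × triElem F ≢ triElem T)
  face-across-chord (mkTri a b c (eab , ebc , eac)) zero chbc with inner-apex ebc (chord-gap chbc)
  ... | u , _ , _ , ebu , euc = mkTri b u c (ebu , euc , ebc) , inj₂ (inj₂ (refl , refl)) ,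
                                λ { refl → Fin.<-irrefl refl (proj₁ eab) }
  face-across-chord (mkTri a b c (eab , ebc , eac)) (suc zero) chac with outer-apex chac
  ... | inj₁ (u , u<a , eua , euc) = mkTri u a c (eua , eac , euc) , inj₂ (inj₁ (refl , refl)) ,
                                     λ { refl → Fin.<-irrefl refl u<a }
  ... | inj₂ (u , c<u , ecu , eau) = mkTri a c u (eac , ecu , eau) , inj₁ (refl , refl) ,
                                     λ { refl → Fin.<-irrefl refl (proj₁ ebc) }
  face-across-chord (mkTri a b c (eab , ebc , eac)) (suc (suc zero)) chab with inner-apex eab (chord-gap chab)
  ... | u , _ , u<b , eau , eub = mkTri a u b (eau , eub , eab) , inj₂ (inj₂ (refl , refl)) ,
                                  λ { refl → Fin.<-irrefl refl u<b }

  critical-exists : ∀ T k → Σ[ x ∈ Elem ] CriticalOf T k x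
  critical-exists T k with side-is-edge T k
  ... | _ , inj₁ cycle = edg _ _ , inj₁ (cycle , refl)
  ... | _ , inj₂ chord with face-across-chord T k chord
  ...   | F , side≺F , F≢T = triElem F , inj₂ (chord , F , refl , side≺F , F≢T)

  side-below-critical : ∀ (L : LinExt) T k {x} → CriticalOf T k x →
    rank L (vtx (proj₁ (opposite T k))) ℕ.< rank L x × rank L (vtx (proj₂ (opposite T k))) ℕ.< rank L x
  side-below-critical L T k = below
    where
      v w : V
      v = proj₁ (opposite T k)
      w = proj₂ (opposite T k)
      evw : Edge v w
      evw = side-is-edge T k
      v<vw : rank L (vtx v) ℕ.< rank L (edg v w)
      v<vw = extends L (vtx v) (edg v w) tt evw (inj₁ refl)
      w<vw : rank L (vtx w) ℕ.< rank L (edg v w)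
      w<vw = extends L (vtx w) (edg v w) tt evw (inj₂ refl)
      below : ∀ {x} → CriticalOf T k x → rank L (vtx v) ℕ.< rank L x × rank L (vtx w) ℕ.< rank L x
      below (inj₁ (_ , refl)) = v<vw , w<vw
      below (inj₂ (_ , F , refl , vw≺F , _)) = <-trans v<vw vw<F , <-trans w<vw vw<F
        where
          vw<F : rank L (edg v w) ℕ.< rank L (triElem F)
          vw<F = extends L (edg v w) (triElem F) evw (isTri F) vw≺F

  corner-below-critical : ∀ (L : LinExt) T {j k x} → j ≢ k → CriticalOf T j x →
                          rank L (vtx (corner T k)) ℕ.< rank L x
  corner-below-critical L T {zero} {zero} j≢k _ = ⊥-elim (j≢k refl)
  corner-below-critical L T {zero} {suc zero} _ cr = proj₁ (side-below-critical L T zero cr)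
  corner-below-critical L T {zero} {suc (suc zero)} _ cr = proj₂ (side-below-critical L T zero cr)
  corner-below-critical L T {suc zero} {zero} _ cr = proj₁ (side-below-critical L T (suc zero) cr)
  corner-below-critical L T {suc zero} {suc zero} j≢k _ = ⊥-elim (j≢k refl)
  corner-below-critical L T {suc zero} {suc (suc zero)} _ cr = proj₂ (side-below-critical L T (suc zero) cr)
  corner-below-critical L T {suc (suc zero)} {zero} _ cr = proj₁ (side-below-critical L T (suc (suc zero)) cr)
  corner-below-critical L T {suc (suc zero)} {suc zero} _ cr = proj₂ (side-below-critical L T (suc (suc zero)) cr)
  corner-below-critical L T {suc (suc zero)} {suc (suc zero)} j≢k _ = ⊥-elim (j≢k refl)

  angle-colours-distinct : ∀ L col → IsAngleColoring L col → ∀ T j k → j ≢ k → col T j ≢ col T k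
  angle-colours-distinct L col colouring T j k j≢k same = <-irrefl refl xj<xj
    where
      open ≤-Reasoning
      Li : LinExt
      Li = L (col T j)
      xj xk : Elem
      xj = proj₁ (critical-exists T j)
      xk = proj₁ (critical-exists T k)
      crj : CriticalOf T j xj
      crj = proj₂ (critical-exists T j)
      crk : CriticalOf T k xk
      crk = proj₂ (critical-exists T k)
      xj<xj : rank Li xj ℕ.< rank Li xj
      xj<xj = begin-strict
        rank Li xj                     <⟨ colouring T j xj crj ⟩
        rank Li (vtx (corner T j))     <⟨ corner-below-critical Li T (j≢k ∘ sym) crk ⟩
        rank Li xk                     <⟨ subst (λ i → rank (L i) xk ℕ.< rank (L i) (vtx (corner T k)))
                                                (sym same) (colouring T k xk crk) ⟩
        rank Li (vtx (corner T k))     <⟨ corner-below-critical Li T j≢k crj ⟩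
        rank Li xj                     ∎

lemma3p4 : (M : MaxOuterMap) → MaxPathLike M →
    (L : Fin 3 → Map.LinExt M) → Map.IsRealizer M L →
    (col : Map.Tri M → Fin 3 → Fin 3) → Map.IsAngleColoring M L col →
    (T : Map.Tri M) →
    (col T zero ≢ col T (suc zero)) × (col T zero ≢ col T (suc (suc zero))) ×
    (col T (suc zero) ≢ col T (suc (suc zero)))
lemma3p4 M _ L _ col colouring T =
  distinct zero (suc zero) (λ ()) ,
  distinct zero (suc (suc zero)) (λ ()) ,
  distinct (suc zero) (suc (suc zero)) (λ ())
  where
    distinct : ∀ j k → j ≢ k → col T j ≢ col T k
    distinct = angle-colours-distinct M L col colouring T
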